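{- Let $Ag$ be a finite set of agents, $A\in Form^{Ag}$, $j,i_1,\dots,i_n\in Ag$ and $t\in Pol$. The following are provable, respectively derivable, in $\Pi$: (T0) $KA\to\Box A$; (R'1) from $A$ infer $\Box A$; (R'2) from $A$ infer $[j]A$; (T1) $t{:}A\to Kt{:}A$; (T2) $t{:}A\to\Box t{:}A$; (T3) $KA\to\Box KA$; (T4) $Proven(t,A)\to\Box Proven(t,A)$; (T5) $\neg\Box(Prove(i_1,t,A)\vee\dots\vee Prove(i_n,t,A))$.
   Context: Language: finite $Ag$; countably infinite $PVar$ (proof variables), $PConst$ (proof constants), $Var$; $Pol$: $t ::= x\mid c\mid s+t\mid s\times t\mid\ !t$; $Form^{Ag}$: $A ::= p\mid A\wedge B\mid\neg A\mid[j]A\mid\Box A\mid t{:}A\mid KA\mid Prove(j,t,A)\mid Proven(t,A)$; $\Diamond=\neg\Box\neg$, $\langle j\rangle=\neg[j]\neg$. Hilbert system $\Pi$: axiom schemes (A0) classical propositional tautologies; (A1) S5 axioms for $\Box$ and each $[j]$; (A2) $\Box A\to[j]A$; (A3) $(\Diamond[j_1]A_1\wedge\dots\wedge\Diamond[j_n]A_n)\to\Diamond([j_1]A_1\wedge\dots\wedge[j_n]A_n)$ for pairwise distinct $j_k$; (A4) $s{:}(A\to B)\to(t{:}A\to(s\times t){:}B)$; (A5) $t{:}A\to(!t{:}(t{:}A)\wedge KA)$; (A6) $(s{:}A\vee t{:}A)\to(s+t){:}A$; (A7) S4 axioms for $K$; (A8) $KA\to\Box K\Box A$; (B9) $Prove(j,t,A)\to(\neg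 Proven(t,A)\wedge[j]Prove(j,t,A)\wedge\neg\Box Prove(j,t,A)\wedge t{:}A)$; (B10) $(Prove(j,t,A)\wedge t{:}B)\to Prove(j,t,B)$; (B11) $Proven(t,A)\to(KProven(t,A)\wedge t{:}A)$; (B12) $(Proven(t,A)\wedge t{:}B)\to Proven(t,B)$; (B13) $\neg Prove(j,t,A)\to\langle j\rangle\bigwedge_{i\in Ag}\neg Prove(i,t,A)$. Rules: (R1) modus ponens; (R2) from $A$ infer $KA$; (S4) from $KA\to(\neg Proven(t_1,B_1)\vee\dots\vee\neg Proven(t_n,B_n))$ infer $KA\to(\bigwedge_{j\in Ag}\neg Prove(j,t_1,B_1)\vee\dots\vee\bigwedge_{j\in Ag}\neg Prove(j,t_n,B_n))$. -}

module Defs where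

open import Data.Nat using (ℕ; zero; suc)
open import Data.Fin using (Fin)
open import Data.Bool using (Bool; true; false; not; _∧_)
open import Data.List using (List; []; _∷_; map; allFin)
open import Data.List.Relation.Unary.Unique.Propositional using (Unique)
open import Data.Product using (_×_; _,_; proj₁; proj₂)
open import Relation.Binary.PropositionalEquality using (_≡_)

-- Proof variables, proof constants and propositional variables are
-- countably infinite: indexed by ℕ.
-- Polynomials (justification terms)  t ::= x | c | s+t | s×t | !t
data Pol : Set where
  pvar   : ℕ → Pol
  pconst : ℕ → Pol
  _⊕_    : Pol → Pol → Pol
  _⊗_    : Pol → Pol → Pol
  !_     : Pol → Pol

module Syntax (m : ℕ) where

  Ag : Set
  Ag = Fin m

  data Form : Set where
    atom   : ℕ → Form
    _∧'_   : Form → Form → Form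
    ¬'_    : Form → Form
    [_]'_  : Ag → Form → Form
    □_     : Form → Form
    _∶_    : Pol → Form → Form
    K_     : Form → Form
    Prove  : Ag → Pol → Form → Form
    Proven : Pol → Form → Form

  infixr 6 _∧'_
  infixr 8 ¬'_ □_ K_ [_]'_
  infixr 7 _∶_

  _∨'_ : Form → Form → Form
  A ∨' B = ¬' (¬' A ∧' ¬' B)

  _⇒_ : Form → Form → Form
  A ⇒ B = ¬' (A ∧' ¬' B)
  infixr 4 _⇒_

  ⊤' : Form
  ⊤' = ¬' (atom 0 ∧' ¬' atom 0)

  infixr 8 ◇_ ⟨_⟩'_
  infixr 5 _∨'_
  ◇_ : Form → Form
  ◇ A = ¬' □ ¬' A

  ⟨_⟩'_ : Ag → Form → Form
  ⟨ j ⟩' A = ¬' [ j ]' ¬' A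

  ⋀ : List Form → Form
  ⋀ []       = ⊤'
  ⋀ (A ∷ []) = A
  ⋀ (A ∷ As) = A ∧' ⋀ As

  ⋁⁺ : Form → List Form → Form
  ⋁⁺ A []       = A
  ⋁⁺ A (B ∷ Bs) = A ∨' ⋁⁺ B Bs

  ⋀Ag : (Ag → Form) → Form
  ⋀Ag f = ⋀ (map f (allFin m))

  -- Classical propositional tautologies: formulas true under every
  -- Boolean assignment to their maximal non-Boolean subformulas.
  eval : (Form → Bool) → Form → Bool
  eval v (A ∧' B) = eval v A ∧ eval v B
  eval v (¬' A)   = not (eval v A)
  eval v A        = v A

  Taut : Form → Set
  Taut A = (v : Form → Bool) → eval v A ≡ true

  infix 2 ⊢_
  data ⊢_ : Form → Set where
    A0    : ∀ {A} → Taut A → ⊢ A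
    K□    : ∀ {A B} → ⊢ (□ (A ⇒ B) ⇒ (□ A ⇒ □ B))
    T□    : ∀ {A} → ⊢ (□ A ⇒ A)
    5□    : ∀ {A} → ⊢ (¬' □ A ⇒ □ ¬' □ A)
    K[]   : ∀ {j A B} → ⊢ ([ j ]' (A ⇒ B) ⇒ ([ j ]' A ⇒ [ j ]' B))
    T[]   : ∀ {j A} → ⊢ ([ j ]' A ⇒ A)
    5[]   : ∀ {j A} → ⊢ (¬' [ j ]' A ⇒ [ j ]' ¬' [ j ]' A)
    A2    : ∀ {j A} → ⊢ (□ A ⇒ [ j ]' A)
    A3    : (ps : List (Ag × Form)) → Unique (map proj₁ ps) →
            ⊢ (⋀ (map (λ p → ◇ ([ proj₁ p ]' proj₂ p)) ps)
                 ⇒ ◇ (⋀ (map (λ p → [ proj₁ p ]' proj₂ p) ps)))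
    A4    : ∀ {s t A B} → ⊢ (s ∶ (A ⇒ B) ⇒ (t ∶ A ⇒ (s ⊗ t) ∶ B))
    A5    : ∀ {t A} → ⊢ (t ∶ A ⇒ ((! t) ∶ (t ∶ A) ∧' K A))
    A6    : ∀ {s t A} → ⊢ ((s ∶ A ∨' t ∶ A) ⇒ (s ⊕ t) ∶ A)
    KK    : ∀ {A B} → ⊢ (K (A ⇒ B) ⇒ (K A ⇒ K B))
    TK    : ∀ {A} → ⊢ (K A ⇒ A)
    4K    : ∀ {A} → ⊢ (K A ⇒ K K A)
    A8    : ∀ {A} → ⊢ (K A ⇒ □ K □ A)
    B9    : ∀ {j t A} → ⊢ (Prove j t A ⇒
              (¬' Proven t A ∧' [ j ]' (Prove j t A) ∧' ¬' □ (Prove j t A) ∧' t ∶ A))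
    B10   : ∀ {j t A B} → ⊢ ((Prove j t A ∧' t ∶ B) ⇒ Prove j t B)
    B11   : ∀ {t A} → ⊢ (Proven t A ⇒ (K (Proven t A) ∧' t ∶ A))
    B12   : ∀ {t A B} → ⊢ ((Proven t A ∧' t ∶ B) ⇒ Proven t B)
    B13   : ∀ {j t A} → ⊢ (¬' Prove j t A ⇒
              ⟨ j ⟩' ⋀Ag (λ i → ¬' Prove i t A))
    MP    : ∀ {A B} → ⊢ (A ⇒ B) → ⊢ A → ⊢ B
    NecK  : ∀ {A} → ⊢ A → ⊢ K A
    -- (S4): (t₁,B₁) ∷ rest  lists the n ≥ 1 pairs (tₖ,Bₖ)
    S4    : ∀ {A} (t₁ : Pol) (B₁ : Form) (rest : List (Pol × Form)) →
            ⊢ (K A ⇒ ⋁⁺ (¬' Proven t₁ B₁)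
                         (map (λ p → ¬' Proven (proj₁ p) (proj₂ p)) rest)) →
            ⊢ (K A ⇒ ⋁⁺ (⋀Ag (λ j → ¬' Prove j t₁ B₁))
                         (map (λ p → ⋀Ag (λ j → ¬' Prove j (proj₁ p) (proj₂ p))) rest))

module Submission where

-- Every tautology Π needs is an instance of a
-- propositional scheme over finitely many schematic variables; a scheme is
-- checked once and for all by evaluating its full truth table, and
-- `tautology` turns a valid scheme into an instance of axiom (A0).
--
-- Modal reasoning.  (T0) K A → □ A follows from (A8) with the T axioms; it
-- gives □-necessitation (R'1), hence [j]-necessitation (R'2), monotonicity
-- of □ and, with the S5 axioms, the S4 principle □ X → □ □ X.  (T1)-(T4)
-- are short chains through (A5), (A7), (B11) and (T0).
--
-- Let N be "no agent proves A by t".  For any agent j, either j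
-- does not prove it, and then (B13) with (A2) gives ◇ N; or j proves it,
-- and then (B9) gives ¬ □ Prove(j,t,A), while □ ¬ N would force
-- □ Prove(j,t,A) by the first case.  So ◇ N is a theorem; as N refutes each
-- disjunct Prove(iₖ,t,A), it refutes their disjunction, which therefore is
-- not necessary.

open import Defs
open import Data.Nat using (ℕ; zero; suc)
open import Data.Fin using (Fin; zero; suc)
open import Data.Bool using (Bool; true; false; not; _∧_)
open import Data.Bool.Properties using (∧-conicalˡ; ∧-conicalʳ)
open import Data.Vec using (Vec; []; _∷_; lookup) renaming (map to mapᵛ)
open import Data.Vec.Properties using (lookup-map)
open import Data.List using (List; []; _∷_; map)
open import Data.List.Membership.Propositional using (_∈_)
open import Data.List.Membership.Propositional.Properties using (∈-map⁺; ∈-allFin)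
open import Data.List.Relation.Unary.Any using (here; there)
open import Data.List.Relation.Unary.All using (All; []; _∷_; universal)
open import Data.List.Relation.Unary.All.Properties using (map⁺)
open import Data.Product using (_×_; _,_)
open import Relation.Binary.PropositionalEquality using (_≡_; refl; sym; cong; cong₂; trans)

data Scheme (n : ℕ) : Set where
  var   : Fin n → Scheme n
  _∧ˢ_  : Scheme n → Scheme n → Scheme n
  ¬ˢ_   : Scheme n → Scheme n

infixr 8 ¬ˢ_
infixr 6 _∧ˢ_
infixr 4 _⇒ˢ_
infixr 5 _∨ˢ_

_⇒ˢ_ : ∀ {n} → Scheme n → Scheme n → Scheme n
S ⇒ˢ T = ¬ˢ (S ∧ˢ ¬ˢ T)

_∨ˢ_ : ∀ {n} → Scheme n → Scheme n → Scheme n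
S ∨ˢ T = ¬ˢ (¬ˢ S ∧ˢ ¬ˢ T)

⟦_⟧ᵇ : ∀ {n} → Scheme n → Vec Bool n → Bool
⟦ var i ⟧ᵇ  β = lookup β i
⟦ S ∧ˢ T ⟧ᵇ β = ⟦ S ⟧ᵇ β ∧ ⟦ T ⟧ᵇ β
⟦ ¬ˢ S ⟧ᵇ   β = not (⟦ S ⟧ᵇ β)

everywhere : ∀ n → (Vec Bool n → Bool) → Bool
everywhere zero    f = f []
everywhere (suc n) f = everywhere n (λ β → f (true ∷ β)) ∧ everywhere n (λ β → f (false ∷ β))

everywhere-sound : ∀ n (f : Vec Bool n → Bool) → everywhere n f ≡ true → ∀ β → f β ≡ true
everywhere-sound zero    f ok []          = ok
everywhere-sound (suc n) f ok (true ∷ β)  =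
  everywhere-sound n _ (∧-conicalˡ _ _ ok) β
everywhere-sound (suc n) f ok (false ∷ β) =
  everywhere-sound n _ (∧-conicalʳ _ _ ok) β

valid : ∀ {n} → Scheme n → Bool
valid {n} S = everywhere n ⟦ S ⟧ᵇ

x₀ : ∀ {n} → Scheme (suc n)
x₀ = var zero

x₁ : ∀ {n} → Scheme (suc (suc n))
x₁ = var (suc zero)

x₂ : ∀ {n} → Scheme (suc (suc (suc n)))
x₂ = var (suc (suc zero))

module Derived (m : ℕ) where
  open Syntax m

  ⟦_⟧ : ∀ {n} → Scheme n → Vec Form n → Form
  ⟦ var i ⟧  ρ = lookup ρ i
  ⟦ S ∧ˢ T ⟧ ρ = ⟦ S ⟧ ρ ∧' ⟦ T ⟧ ρ
  ⟦ ¬ˢ S ⟧   ρ = ¬' ⟦ S ⟧ ρ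

  eval-⟦⟧ : ∀ {n} (v : Form → Bool) (S : Scheme n) (ρ : Vec Form n) →
            eval v (⟦ S ⟧ ρ) ≡ ⟦ S ⟧ᵇ (mapᵛ (eval v) ρ)
  eval-⟦⟧ v (var i)  ρ = sym (lookup-map i (eval v) ρ)
  eval-⟦⟧ v (S ∧ˢ T) ρ = cong₂ _∧_ (eval-⟦⟧ v S ρ) (eval-⟦⟧ v T ρ)
  eval-⟦⟧ v (¬ˢ S)   ρ = cong not (eval-⟦⟧ v S ρ)

  tautology : ∀ {n} (S : Scheme n) → valid S ≡ true → (ρ : Vec Form n) → ⊢ ⟦ S ⟧ ρ
  tautology {n} S ok ρ = A0 λ v →
    trans (eval-⟦⟧ v S ρ) (everywhere-sound n ⟦ S ⟧ᵇ ok (mapᵛ (eval v) ρ))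

  ⇒-refl : ∀ {A} → ⊢ (A ⇒ A)
  ⇒-refl {A} = tautology (x₀ ⇒ˢ x₀) refl (A ∷ [])

  ∧-elimˡ : ∀ {A B} → ⊢ (A ∧' B ⇒ A)
  ∧-elimˡ {A} {B} = tautology (x₀ ∧ˢ x₁ ⇒ˢ x₀) refl (A ∷ B ∷ [])

  ∧-elimʳ : ∀ {A B} → ⊢ (A ∧' B ⇒ B)
  ∧-elimʳ {A} {B} = tautology (x₀ ∧ˢ x₁ ⇒ˢ x₁) refl (A ∷ B ∷ [])

  ⇒-trans : ∀ {A B C} → ⊢ (A ⇒ B) → ⊢ (B ⇒ C) → ⊢ (A ⇒ C)
  ⇒-trans {A} {B} {C} p q =
    MP (MP (tautology ((x₀ ⇒ˢ x₁) ⇒ˢ (x₁ ⇒ˢ x₂) ⇒ˢ (x₀ ⇒ˢ x₂)) refl (A ∷ B ∷ C ∷ [])) p) q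

  contraposition : ∀ {A B} → ⊢ (A ⇒ B) → ⊢ (¬' B ⇒ ¬' A)
  contraposition {A} {B} =
    MP (tautology ((x₀ ⇒ˢ x₁) ⇒ˢ (¬ˢ x₁ ⇒ˢ ¬ˢ x₀)) refl (A ∷ B ∷ []))

  contrapositionᶜ : ∀ {A B} → ⊢ (¬' A ⇒ ¬' B) → ⊢ (B ⇒ A)
  contrapositionᶜ {A} {B} =
    MP (tautology ((¬ˢ x₀ ⇒ˢ ¬ˢ x₁) ⇒ˢ (x₁ ⇒ˢ x₀)) refl (A ∷ B ∷ []))

  contraposition¬ : ∀ {A B} → ⊢ (¬' A ⇒ B) → ⊢ (¬' B ⇒ A)
  contraposition¬ {A} {B} =
    MP (tautology ((¬ˢ x₀ ⇒ˢ x₁) ⇒ˢ (¬ˢ x₁ ⇒ˢ x₀)) refl (A ∷ B ∷ []))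

  incompatible-sym : ∀ {A B} → ⊢ (A ⇒ ¬' B) → ⊢ (B ⇒ ¬' A)
  incompatible-sym {A} {B} =
    MP (tautology ((x₀ ⇒ˢ ¬ˢ x₁) ⇒ˢ (x₁ ⇒ˢ ¬ˢ x₀)) refl (A ∷ B ∷ []))

  by-cases : ∀ {A C} → ⊢ (A ⇒ C) → ⊢ (¬' A ⇒ C) → ⊢ C
  by-cases {A} {C} p q =
    MP (MP (tautology ((x₀ ⇒ˢ x₁) ⇒ˢ (¬ˢ x₀ ⇒ˢ x₁) ⇒ˢ x₁) refl (A ∷ C ∷ [])) p) q

  refute-∨ : ∀ {C A B} → ⊢ (C ⇒ ¬' A) → ⊢ (C ⇒ ¬' B) → ⊢ (C ⇒ ¬' (A ∨' B))
  refute-∨ {C} {A} {B} p q =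
    MP (MP (tautology ((x₀ ⇒ˢ ¬ˢ x₁) ⇒ˢ (x₀ ⇒ˢ ¬ˢ x₂) ⇒ˢ (x₀ ⇒ˢ ¬ˢ (x₁ ∨ˢ x₂)))
                      refl (C ∷ A ∷ B ∷ [])) p) q

  ⋀-elim : ∀ {A As} → A ∈ As → ⊢ (⋀ As ⇒ A)
  ⋀-elim {As = _ ∷ []}    (here refl) = ⇒-refl
  ⋀-elim {As = _ ∷ _ ∷ _} (here refl) = ∧-elimˡ
  ⋀-elim {As = _ ∷ _ ∷ _} (there p)   = ⇒-trans ∧-elimʳ (⋀-elim p)

  ⋁⁺-refute : ∀ {C A Bs} → All (λ B → ⊢ (C ⇒ ¬' B)) (A ∷ Bs) → ⊢ (C ⇒ ¬' ⋁⁺ A Bs)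
  ⋁⁺-refute {Bs = []}    (p ∷ []) = p
  ⋁⁺-refute {Bs = _ ∷ _} (p ∷ ps) = refute-∨ p (⋁⁺-refute ps)

  K⇒□ : ∀ {A} → ⊢ (K A ⇒ □ A)
  K⇒□ = ⇒-trans A8 (⇒-trans T□ TK)

  □-nec : ∀ {A} → ⊢ A → ⊢ □ A
  □-nec p = MP K⇒□ (NecK p)

  []-nec : ∀ {j A} → ⊢ A → ⊢ [ j ]' A
  []-nec p = MP A2 (□-nec p)

  □-mono : ∀ {A B} → ⊢ (A ⇒ B) → ⊢ (□ A ⇒ □ B)
  □-mono p = MP K□ (□-nec p)

  -- Axiom 4 for □, derived from T and 5.
  □-4 : ∀ {X} → ⊢ (□ X ⇒ □ □ X)
  □-4 {X} = ⇒-trans (incompatible-sym (T□ {¬' □ X}))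
                    (⇒-trans 5□ (□-mono (contraposition¬ 5□)))

  □-lift : ∀ {X Y} → ⊢ (□ X ⇒ Y) → ⊢ (□ X ⇒ □ Y)
  □-lift p = ⇒-trans □-4 (□-mono p)

  ⟨⟩⇒◇ : ∀ {j X} → ⊢ (⟨ j ⟩' X ⇒ ◇ X)
  ⟨⟩⇒◇ {j} = contraposition (A2 {j})

  ¬□-refuted : ∀ {N D} → ⊢ (N ⇒ ¬' D) → ⊢ ◇ N → ⊢ ¬' □ D
  ¬□-refuted p = MP (contraposition (□-mono (incompatible-sym p)))

  proof⇒K-proof : ∀ {t A} → ⊢ (t ∶ A ⇒ K (t ∶ A))
  proof⇒K-proof = ⇒-trans (⇒-trans A5 ∧-elimˡ) (⇒-trans A5 ∧-elimʳ)

  module NobodyProves (t : Pol) (A : Form) where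

    Nobody : Form
    Nobody = ⋀Ag (λ i → ¬' Prove i t A)

    nobody⇒unproved : ∀ i → ⊢ (Nobody ⇒ ¬' Prove i t A)
    nobody⇒unproved i = ⋀-elim (∈-map⁺ (λ i → ¬' Prove i t A) (∈-allFin i))

    unproved⇒◇nobody : ∀ {j} → ⊢ (¬' Prove j t A ⇒ ◇ Nobody)
    unproved⇒◇nobody = ⇒-trans B13 ⟨⟩⇒◇

    -- (B9): a proving is never necessary; but □ ¬ Nobody would make it so.
    proved⇒◇nobody : ∀ {j} → ⊢ (Prove j t A ⇒ ◇ Nobody)
    proved⇒◇nobody = ⇒-trans (⇒-trans B9 (⇒-trans ∧-elimʳ (⇒-trans ∧-elimʳ ∧-elimˡ)))
                             (contraposition (□-lift (contrapositionᶜ unproved⇒◇nobody)))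

    -- Either way nobody's proving is possible, as soon as some agent exists.
    ◇nobody : Ag → ⊢ ◇ Nobody
    ◇nobody j = by-cases (proved⇒◇nobody {j}) unproved⇒◇nobody

    ¬□someone-proves : ∀ i₁ is → ⊢ ¬' □ ⋁⁺ (Prove i₁ t A) (map (λ i → Prove i t A) is)
    ¬□someone-proves i₁ is =
      ¬□-refuted (⋁⁺-refute (map⁺ (universal nobody⇒unproved (i₁ ∷ is)))) (◇nobody i₁)

lemma3 : (m : ℕ) → let open Syntax m in
    (A : Form) (j : Ag) (t : Pol) (i₁ : Ag) (is : List Ag) →
      (⊢ (K A ⇒ □ A))
    × ((⊢ A → ⊢ (□ A))
    × ((⊢ A → ⊢ ([ j ]' A))
    × ((⊢ (t ∶ A ⇒ K (t ∶ A)))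
    × ((⊢ (t ∶ A ⇒ □ (t ∶ A)))
    × ((⊢ (K A ⇒ □ (K A)))
    × ((⊢ (Proven t A ⇒ □ (Proven t A)))
    × (⊢ (¬' □ (⋁⁺ (Prove i₁ t A) (map (λ i → Prove i t A) is))))))))))
lemma3 m A j t i₁ is =
    K⇒□
  , □-nec
  , []-nec
  , proof⇒K-proof
  , ⇒-trans proof⇒K-proof K⇒□
  , ⇒-trans 4K K⇒□
  , ⇒-trans (⇒-trans B11 ∧-elimˡ) K⇒□
  , NobodyProves.¬□someone-proves t A i₁ is
  where
    open Syntax m
    open Derived m
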